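{- Let $g > 5$ and $2 \leq n \leq 3$ be integers, and let $G = C_g + P_n$ be the disjoint union of a cycle $C_g$ on $g$ vertices and a path $P_n$ on $n$ vertices. Then there exists a special permutation of $V(G)$, i.e. a bijection $\sigma: V(G) \to V(G)$ such that for every edge $xy$ of $G$, the vertices $\sigma(x)$ and $\sigma(y)$ are distinct and non-adjacent in $G$.
   Context: Graphs are finite and simple; $C_g$ and $P_n$ denote a cycle with $g$ vertices and a path with $n$ vertices, and $G_1 + G_2$ denotes the disjoint union of graphs $G_1, G_2$. For a graph $G$, a permutation $\sigma$ of $V(G)$ is called a special permutation of $V(G)$ if for every edge $xy \in E(G)$, $\sigma(x)\sigma(y)$ is an edge of the complement $\overline{G}$ of $G$ (equivalently, $\sigma(x)$ and $\sigma(y)$ are non-adjacent in $G$). -}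

module Defs where

open import Data.Nat using (ℕ; suc)
open import Data.Fin using (Fin; toℕ)
open import Data.Sum using (_⊎_; inj₁; inj₂)
open import Data.Empty using (⊥)
open import Data.Product using (_×_)
open import Relation.Binary.PropositionalEquality using (_≡_)
open import Relation.Nullary using (¬_)
open import Function.Bundles using (_↔_; Inverse)

-- A (simple) graph on vertex type V, given by its adjacency relation.
-- (Symmetry/irreflexivity hold for the concrete graphs below.)
record Graph (V : Set) : Set₁ where
  field
    Adj : V → V → Set

open Graph public

pathAdj : (n : ℕ) → Fin n → Fin n → Set
pathAdj n i j = (toℕ j ≡ suc (toℕ i)) ⊎ (toℕ i ≡ suc (toℕ j))

-- Cycle C_g on vertices Fin g (g ≥ 3): i ~ j iff j = i+1 mod g or i = j+1 mod g.
-- Written without `mod`: j = i+1, or {i,j} = {g-1, 0} (the closing edge).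
cycleAdj : (g : ℕ) → Fin g → Fin g → Set
cycleAdj g i j = pathAdj g i j ⊎ ((suc (toℕ i) ≡ g × toℕ j ≡ 0) ⊎ (suc (toℕ j) ≡ g × toℕ i ≡ 0))


_⊕_ : {V W : Set} → Graph V → Graph W → Graph (V ⊎ W)
Adj (G ⊕ H) (inj₁ x) (inj₁ y) = Adj G x y
Adj (G ⊕ H) (inj₂ x) (inj₂ y) = Adj H x y
Adj (G ⊕ H) (inj₁ _) (inj₂ _) = ⊥
Adj (G ⊕ H) (inj₂ _) (inj₁ _) = ⊥

C : (g : ℕ) → Graph (Fin g)
Adj (C g) = cycleAdj g

P : (n : ℕ) → Graph (Fin n)
Adj (P n) = pathAdj n

IsSpecial : {V : Set} → (G : Graph V) → (V ↔ V) → Set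
IsSpecial {V} G σ = ∀ (x y : V) → Adj G x y →
  ¬ (Inverse.to σ x ≡ Inverse.to σ y) × ¬ Adj G (Inverse.to σ x) (Inverse.to σ y)

-- For 6 ≤ g ≤ 9 a special permutation of C_g + P_n is found and checked by computation.
-- One of C_g + Γ yields one of C_(g+4) + Γ: cut the cycle between its last vertex and 0 and
-- insert a path 0 – 1 – 2 – 3 there, permuted by ρ = (0 ↦ 2, 1 ↦ 0, 2 ↦ 3, 3 ↦ 1) while the old
-- permutation acts on the old vertices. ρ is special for P₄, every edge between old vertices is
-- an old edge, and each remaining edge joins an endpoint 0 or 3 of the inserted path to an old
-- vertex; ρ sends these endpoints to the interior vertices 2 and 1, which have no old neighbours.
module Submission where

open import Defs
open import Data.Empty using (⊥-elim)
open import Data.Fin using (Fin; toℕ; #_; _↑ˡ_; _↑ʳ_; join)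
open import Data.Fin.Patterns using (0F; 1F; 2F; 3F)
open import Data.Fin.Properties using (toℕ<n; toℕ-↑ˡ; toℕ-↑ʳ; +↔⊎; all?; _≟_)
import Data.Nat as ℕ
open import Data.Nat using (ℕ; suc; _+_; _<_; _≤_; s≤s; z<s)
open import Data.Nat.Properties using (+-suc; +-cancelˡ-≡; m<m+n; <⇒≱; module ≤-Reasoning)
open import Data.Product using (Σ; _×_; _,_; proj₁; proj₂)
import Data.Product as Product
open import Data.Sum using (_⊎_; inj₁; inj₂; [_,_])
import Data.Sum as Sum
open import Data.Sum.Algebra using (⊎-cong; ⊎-assoc)
open import Data.Sum.Properties using (inj₁-injective; inj₂-injective; ≡-dec)
open import Data.Vec using (Vec; []; _∷_; lookup)
open import Function using (_∘_; id)
open import Function.Bundles using (_↔_; Inverse; mk↔ₛ′)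
open import Function.Properties.Inverse using (↔-refl; ↔-sym; ↔-trans)
open import Level using (0ℓ)
open import Relation.Binary.Definitions using (DecidableEquality)
open import Relation.Binary.PropositionalEquality
  using (_≡_; _≢_; sym; cong; subst₂; module ≡-Reasoning)
open import Relation.Nullary using (¬_; Dec; no; map′)
open import Relation.Nullary.Decidable using (True; toWitness; from-yes; _×-dec_; _⊎-dec_; _→-dec_; ¬?)
open import Relation.Unary using (Decidable)

open Inverse using (to; from)

SpecialPermutation : {V : Set} → Graph V → Set
SpecialPermutation {V} G = Σ (V ↔ V) (IsSpecial G)

pullback : {U V : Set} → (U → V) → Graph V → Graph U
Adj (pullback f G) x y = Adj G (f x) (f y)

_⊆_ : {V : Set} → Graph V → Graph V → Set
G ⊆ H = ∀ x y → Adj G x y → Adj H x y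

conjugate : {U V : Set} → U ↔ V → U ↔ U → V ↔ V
conjugate ψ τ = ↔-trans (↔-sym ψ) (↔-trans τ ψ)

special-conjugate : {U V : Set} {G : Graph V} (ψ : U ↔ V) (τ : U ↔ U) →
  IsSpecial (pullback (to ψ) G) τ → IsSpecial G (conjugate ψ τ)
special-conjugate {G = G} ψ τ τ-special x y xy =
  Product.map (_∘ to-injective) id (τ-special (from ψ x) (from ψ y) edge)
  where
  to-injective : ∀ {a b} → to ψ a ≡ to ψ b → a ≡ b
  to-injective {a} {b} eq =
    subst₂ _≡_ (Inverse.strictlyInverseʳ ψ a) (Inverse.strictlyInverseʳ ψ b) (cong (from ψ) eq)

  edge : Adj G (to ψ (from ψ x)) (to ψ (from ψ y))
  edge = subst₂ (Adj G) (sym (Inverse.strictlyInverseˡ ψ x)) (sym (Inverse.strictlyInverseˡ ψ y)) xy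

module _ {A B : Set} (K : Graph (A ⊎ B)) where

  Detached : A → Set
  Detached a = ∀ b → ¬ Adj K (inj₁ a) (inj₂ b) × ¬ Adj K (inj₂ b) (inj₁ a)

  special-⊎ : {G : Graph A} {H : Graph B} {ρ : A ↔ A} {σ : B ↔ B} →
    pullback inj₁ K ⊆ G → pullback inj₂ K ⊆ H →
    (∀ a → Detached a ⊎ Detached (to ρ a)) →
    IsSpecial G ρ → IsSpecial H σ → IsSpecial K (⊎-cong ρ σ)
  special-⊎ {G} {H} {ρ} {σ} K₁⊆G K₂⊆H detached ρ-special σ-special = special
    where
    inside : {X : Set} (ι : X → A ⊎ B) {L : Graph X} {τ : X ↔ X} →
      (∀ {x x′} → ι x ≡ ι x′ → x ≡ x′) → pullback ι K ⊆ L → IsSpecial L τ →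
      ∀ x x′ → Adj K (ι x) (ι x′) →
      ¬ ι (to τ x) ≡ ι (to τ x′) × ¬ Adj K (ι (to τ x)) (ι (to τ x′))
    inside ι ι-injective K⊆L τ-special x x′ e =
      Product.map (_∘ ι-injective) (_∘ K⊆L _ _) (τ-special x x′ (K⊆L x x′ e))

    special : IsSpecial K (⊎-cong ρ σ)
    special (inj₁ a) (inj₁ a′) = inside inj₁ {G} {ρ} inj₁-injective K₁⊆G ρ-special a a′
    special (inj₂ b) (inj₂ b′) = inside inj₂ {H} {σ} inj₂-injective K₂⊆H σ-special b b′
    special (inj₁ a) (inj₂ b) e with detached a
    ... | inj₁ a-detached = ⊥-elim (proj₁ (a-detached b) e)
    ... | inj₂ ρa-detached = (λ ()) , proj₁ (ρa-detached (to σ b))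
    special (inj₂ b) (inj₁ a) e with detached a
    ... | inj₁ a-detached = ⊥-elim (proj₂ (a-detached b) e)
    ... | inj₂ ρa-detached = (λ ()) , proj₂ (ρa-detached (to σ b))

pathAdj-reflect : ∀ {m m′} {f : Fin m → Fin m′} k → (∀ i → toℕ (f i) ≡ k + toℕ i) →
  ∀ {i j} → pathAdj m′ (f i) (f j) → pathAdj m i j
pathAdj-reflect {f = f} k toℕ-f {i} {j} = Sum.map (successor i j) (successor j i)
  where
  open ≡-Reasoning
  successor : ∀ i j → toℕ (f j) ≡ suc (toℕ (f i)) → toℕ j ≡ suc (toℕ i)
  successor i j eq = +-cancelˡ-≡ k _ _ (begin
    k + toℕ j          ≡⟨ sym (toℕ-f j) ⟩
    toℕ (f j)          ≡⟨ eq ⟩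
    suc (toℕ (f i))    ≡⟨ cong suc (toℕ-f i) ⟩
    suc (k + toℕ i)    ≡⟨ sym (+-suc k (toℕ i)) ⟩
    k + suc (toℕ i)    ∎)

cycleAdj-sym : ∀ {g} {i j : Fin g} → cycleAdj g i j → cycleAdj g j i
cycleAdj-sym = Sum.map Sum.swap Sum.swap

↑ˡ-not-last : ∀ {m} n (i : Fin m) → suc (toℕ (i ↑ˡ suc n)) ≢ m + suc n
↑ˡ-not-last {m} n i eq = <⇒≱ (m<m+n m z<s) (begin
  m + suc n                ≡⟨ sym eq ⟩
  suc (toℕ (i ↑ˡ suc n))   ≡⟨ cong suc (toℕ-↑ˡ i (suc n)) ⟩
  suc (toℕ i)              ≤⟨ toℕ<n i ⟩
  m                        ∎)
  where open ≤-Reasoning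

cycleAdj-↑ˡ : ∀ {m} n {i j : Fin m} → cycleAdj (m + suc n) (i ↑ˡ suc n) (j ↑ˡ suc n) → pathAdj m i j
cycleAdj-↑ˡ n (inj₁ ij) = pathAdj-reflect 0 (λ i → toℕ-↑ˡ i (suc n)) ij
cycleAdj-↑ˡ n {i} (inj₂ (inj₁ (i-last , _))) = ⊥-elim (↑ˡ-not-last n i i-last)
cycleAdj-↑ˡ n {j = j} (inj₂ (inj₂ (j-last , _))) = ⊥-elim (↑ˡ-not-last n j j-last)

cycleAdj-↑ʳ : ∀ m {n} {i j : Fin n} → cycleAdj (suc m + n) (suc m ↑ʳ i) (suc m ↑ʳ j) → pathAdj n i j
cycleAdj-↑ʳ m (inj₁ ij) = pathAdj-reflect (suc m) (toℕ-↑ʳ (suc m)) ij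
cycleAdj-↑ʳ m (inj₂ (inj₁ (_ , ())))
cycleAdj-↑ʳ m (inj₂ (inj₂ (_ , ())))

Exhaustible : Set → Set₁
Exhaustible V = ∀ {P : V → Set} → Decidable P → Dec (∀ x → P x)

all?-⊎ : {A B : Set} → Exhaustible A → Exhaustible B → Exhaustible (A ⊎ B)
all?-⊎ all?ᴬ all?ᴮ P? =
  map′ (λ (f , g) → [ f , g ]) (λ h → h ∘ inj₁ , h ∘ inj₂) (all?ᴬ (P? ∘ inj₁) ×-dec all?ᴮ (P? ∘ inj₂))

pathAdj? : ∀ n (i j : Fin n) → Dec (pathAdj n i j)
pathAdj? n i j = (toℕ j ℕ.≟ suc (toℕ i)) ⊎-dec (toℕ i ℕ.≟ suc (toℕ j))

cycleAdj? : ∀ g (i j : Fin g) → Dec (cycleAdj g i j)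
cycleAdj? g i j = pathAdj? g i j ⊎-dec (closing i j ⊎-dec closing j i)
  where
  closing : ∀ i j → Dec (suc (toℕ i) ≡ g × toℕ j ≡ 0)
  closing i j = (suc (toℕ i) ℕ.≟ g) ×-dec (toℕ j ℕ.≟ 0)

⊕-adj? : {V W : Set} {G : Graph V} {H : Graph W} →
  (∀ x y → Dec (Adj G x y)) → (∀ x y → Dec (Adj H x y)) → ∀ x y → Dec (Adj (G ⊕ H) x y)
⊕-adj? G? H? (inj₁ x) (inj₁ y) = G? x y
⊕-adj? G? H? (inj₂ x) (inj₂ y) = H? x y
⊕-adj? G? H? (inj₁ _) (inj₂ _) = no λ ()
⊕-adj? G? H? (inj₂ _) (inj₁ _) = no λ ()

module Finite {V : Set} {m : ℕ} (index : V → Fin m)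
  (all?ⱽ : Exhaustible V) (_≟ⱽ_ : DecidableEquality V) where

  tabulated : Vec V m → V → V
  tabulated t = lookup t ∘ index

  permutation : (t u : Vec V m) →
    {True (all?ⱽ λ y → tabulated t (tabulated u y) ≟ⱽ y)} →
    {True (all?ⱽ λ x → tabulated u (tabulated t x) ≟ⱽ x)} → V ↔ V
  permutation t u {t∘u≗id} {u∘t≗id} =
    mk↔ₛ′ (tabulated t) (tabulated u) (toWitness t∘u≗id) (toWitness u∘t≗id)

  module _ {G : Graph V} (adj? : ∀ x y → Dec (Adj G x y)) where

    special? : (σ : V ↔ V) → Dec (IsSpecial G σ)
    special? σ = all?ⱽ λ x → all?ⱽ λ y →
      adj? x y →-dec (¬? (to σ x ≟ⱽ to σ y) ×-dec ¬? (adj? (to σ x) (to σ y)))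

module P₄ = Finite {Fin 4} id all? _≟_

ρ : Fin 4 ↔ Fin 4
ρ = P₄.permutation (# 2 ∷ # 0 ∷ # 3 ∷ # 1 ∷ []) (# 1 ∷ # 3 ∷ # 0 ∷ # 2 ∷ [])

ρ-special : IsSpecial (P 4) ρ
ρ-special = from-yes (P₄.special? (pathAdj? 4) ρ)

module _ {W : Set} (Γ : Graph W) (g : ℕ) where

  private
    -- Vertex k of P₄ becomes cycle vertex k, and old cycle vertex i becomes i + 4.
    splice : (Fin 4 ⊎ (Fin (suc g) ⊎ W)) ↔ (Fin (4 + suc g) ⊎ W)
    splice = ↔-trans (↔-sym (⊎-assoc 0ℓ (Fin 4) (Fin (suc g)) W)) (⊎-cong (↔-sym +↔⊎) ↔-refl)

    K : Graph (Fin 4 ⊎ (Fin (suc g) ⊎ W))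
    K = pullback (to splice) (C (4 + suc g) ⊕ Γ)

    old-edges : pullback inj₂ K ⊆ (C (suc g) ⊕ Γ)
    old-edges (inj₁ _) (inj₁ _) e = inj₁ (cycleAdj-↑ʳ 3 e)
    old-edges (inj₂ _) (inj₂ _) e = e

    no-old-neighbour⇒detached : ∀ {k} → (∀ j → ¬ cycleAdj (4 + suc g) (k ↑ˡ suc g) (4 ↑ʳ j)) →
      Detached K k
    no-old-neighbour⇒detached k≁ (inj₁ j) = k≁ j , k≁ j ∘ cycleAdj-sym
    no-old-neighbour⇒detached k≁ (inj₂ _) = (λ ()) , (λ ())

    1-detached : Detached K 1F
    1-detached = no-old-neighbour⇒detached λ _ → λ
      { (inj₁ (inj₁ ())) ; (inj₁ (inj₂ ())) ; (inj₂ (inj₁ (() , _))) ; (inj₂ (inj₂ (_ , ()))) }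

    2-detached : Detached K 2F
    2-detached = no-old-neighbour⇒detached λ _ → λ
      { (inj₁ (inj₁ ())) ; (inj₁ (inj₂ ())) ; (inj₂ (inj₁ (() , _))) ; (inj₂ (inj₂ (_ , ()))) }

    detached-or-image-detached : ∀ k → Detached K k ⊎ Detached K (to ρ k)
    detached-or-image-detached 0F = inj₂ 2-detached
    detached-or-image-detached 1F = inj₁ 1-detached
    detached-or-image-detached 2F = inj₁ 2-detached
    detached-or-image-detached 3F = inj₂ 1-detached

  insert-P₄ : SpecialPermutation (C (suc g) ⊕ Γ) → SpecialPermutation (C (4 + suc g) ⊕ Γ)
  insert-P₄ (σ , σ-special) =
    conjugate splice (⊎-cong ρ σ) ,
    special-conjugate {G = C (4 + suc g) ⊕ Γ} splice (⊎-cong ρ σ)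
      (special-⊎ K {P 4} {C (suc g) ⊕ Γ} {ρ} {σ}
        (λ _ _ → cycleAdj-↑ˡ g) old-edges detached-or-image-detached ρ-special σ-special)

-- c i and p i are vertex i of the cycle and of the path; tables list the images of
-- c 0, …, c (g - 1), p 0, …, p (n - 1) in this order, and the second table is the inverse.
module C⊕P (g n : ℕ) where
  open Finite (join g n) (all?-⊎ all? all?) (≡-dec _≟_ _≟_) public

  c : ∀ i {i<g : True (suc i ℕ.≤? g)} → Fin g ⊎ Fin n
  c i {i<g} = inj₁ ((# i) {m<n = i<g})

  p : ∀ i {i<n : True (suc i ℕ.≤? n)} → Fin g ⊎ Fin n
  p i {i<n} = inj₂ ((# i) {m<n = i<n})

  special-by-computation : (σ : (Fin g ⊎ Fin n) ↔ (Fin g ⊎ Fin n)) →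
    {True (special? (⊕-adj? (cycleAdj? g) (pathAdj? n)) σ)} → SpecialPermutation (C g ⊕ P n)
  special-by-computation σ {σ-special} = σ , toWitness σ-special

C6⊕P2 : SpecialPermutation (C 6 ⊕ P 2)
C6⊕P2 = special-by-computation (permutation
  (c 3 ∷ p 0 ∷ c 1 ∷ c 5 ∷ p 1 ∷ c 0 ∷ c 4 ∷ c 2 ∷ [])
  (c 5 ∷ c 2 ∷ p 1 ∷ c 0 ∷ p 0 ∷ c 3 ∷ c 1 ∷ c 4 ∷ []))
  where open C⊕P 6 2

C7⊕P2 : SpecialPermutation (C 7 ⊕ P 2)
C7⊕P2 = special-by-computation (permutation
  (c 3 ∷ c 6 ∷ c 4 ∷ c 0 ∷ c 2 ∷ c 5 ∷ p 0 ∷ c 1 ∷ p 1 ∷ [])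
  (c 3 ∷ p 0 ∷ c 4 ∷ c 0 ∷ c 2 ∷ c 5 ∷ c 1 ∷ c 6 ∷ p 1 ∷ []))
  where open C⊕P 7 2

C8⊕P2 : SpecialPermutation (C 8 ⊕ P 2)
C8⊕P2 = special-by-computation (permutation
  (c 7 ∷ c 2 ∷ p 0 ∷ c 1 ∷ c 4 ∷ c 0 ∷ c 5 ∷ p 1 ∷ c 3 ∷ c 6 ∷ [])
  (c 5 ∷ c 3 ∷ c 1 ∷ p 0 ∷ c 4 ∷ c 6 ∷ p 1 ∷ c 0 ∷ c 2 ∷ c 7 ∷ []))
  where open C⊕P 8 2

C9⊕P2 : SpecialPermutation (C 9 ⊕ P 2)
C9⊕P2 = special-by-computation (permutation
  (c 6 ∷ c 8 ∷ p 1 ∷ c 7 ∷ c 5 ∷ c 3 ∷ c 0 ∷ c 4 ∷ c 1 ∷ p 0 ∷ c 2 ∷ [])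
  (c 6 ∷ c 8 ∷ p 1 ∷ c 5 ∷ c 7 ∷ c 4 ∷ c 0 ∷ c 3 ∷ c 1 ∷ p 0 ∷ c 2 ∷ []))
  where open C⊕P 9 2

C6⊕P3 : SpecialPermutation (C 6 ⊕ P 3)
C6⊕P3 = special-by-computation (permutation
  (p 1 ∷ c 5 ∷ c 2 ∷ c 4 ∷ p 0 ∷ c 0 ∷ p 2 ∷ c 1 ∷ c 3 ∷ [])
  (c 5 ∷ p 1 ∷ c 2 ∷ p 2 ∷ c 3 ∷ c 1 ∷ c 4 ∷ c 0 ∷ p 0 ∷ []))
  where open C⊕P 6 3

C7⊕P3 : SpecialPermutation (C 7 ⊕ P 3)
C7⊕P3 = special-by-computation (permutation
  (p 0 ∷ c 2 ∷ p 1 ∷ c 1 ∷ c 4 ∷ c 0 ∷ c 5 ∷ p 2 ∷ c 3 ∷ c 6 ∷ [])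
  (c 5 ∷ c 3 ∷ c 1 ∷ p 1 ∷ c 4 ∷ c 6 ∷ p 2 ∷ c 0 ∷ c 2 ∷ p 0 ∷ []))
  where open C⊕P 7 3

C8⊕P3 : SpecialPermutation (C 8 ⊕ P 3)
C8⊕P3 = special-by-computation (permutation
  (c 6 ∷ p 0 ∷ p 2 ∷ c 7 ∷ c 5 ∷ c 3 ∷ c 0 ∷ c 4 ∷ c 1 ∷ p 1 ∷ c 2 ∷ [])
  (c 6 ∷ p 0 ∷ p 2 ∷ c 5 ∷ c 7 ∷ c 4 ∷ c 0 ∷ c 3 ∷ c 1 ∷ p 1 ∷ c 2 ∷ []))
  where open C⊕P 8 3

C9⊕P3 : SpecialPermutation (C 9 ⊕ P 3)
C9⊕P3 = special-by-computation (permutation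
  (c 4 ∷ c 7 ∷ c 2 ∷ c 6 ∷ c 1 ∷ p 2 ∷ c 3 ∷ c 8 ∷ p 0 ∷ p 1 ∷ c 0 ∷ c 5 ∷ [])
  (p 1 ∷ c 4 ∷ c 2 ∷ c 6 ∷ c 0 ∷ p 2 ∷ c 3 ∷ c 1 ∷ c 7 ∷ c 8 ∷ p 0 ∷ c 5 ∷ []))
  where open C⊕P 9 3

module _ {W : Set} (Γ : Graph W)
  (s₆ : SpecialPermutation (C 6 ⊕ Γ)) (s₇ : SpecialPermutation (C 7 ⊕ Γ))
  (s₈ : SpecialPermutation (C 8 ⊕ Γ)) (s₉ : SpecialPermutation (C 9 ⊕ Γ)) where

  special-C⊕ : ∀ k → SpecialPermutation (C (6 + k) ⊕ Γ)
  special-C⊕ 0 = s₆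
  special-C⊕ 1 = s₇
  special-C⊕ 2 = s₈
  special-C⊕ 3 = s₉
  special-C⊕ (suc (suc (suc (suc k)))) = insert-P₄ Γ (5 + k) (special-C⊕ k)

lemma5 : (g n : ℕ) → 5 < g → 2 ≤ n → n ≤ 3 →
    Σ ((Fin g ⊎ Fin n) ↔ (Fin g ⊎ Fin n)) (λ σ → IsSpecial (C g ⊕ P n) σ)
lemma5 _ 0 _ () _
lemma5 _ 1 _ (s≤s ()) _
lemma5 _ 2 (s≤s (s≤s (s≤s (s≤s (s≤s (s≤s {n = k} _)))))) _ _ =
  special-C⊕ (P 2) C6⊕P2 C7⊕P2 C8⊕P2 C9⊕P2 k
lemma5 _ 3 (s≤s (s≤s (s≤s (s≤s (s≤s (s≤s {n = k} _)))))) _ _ =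
  special-C⊕ (P 3) C6⊕P3 C7⊕P3 C8⊕P3 C9⊕P3 k
lemma5 _ (suc (suc (suc (suc _)))) _ _ (s≤s (s≤s (s≤s ())))
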